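{- Let $G$ be a graph, let $\mathcal{Y}$ be a clique partition of $G$, and for each integer $k\geq 0$ let $\lambda(k):=\min\{|E(\mathcal{Y}-X)| : X\subseteq V(G),\ |X|=k\}$. Let $C$ be a subset of $V(G)$ of size $k$. If $|E(\mathcal{Y}-C)|=\lambda(k)$, then there exists an ordering $c_1,\dots,c_k$ of $C$ such that for every $i\in[k]$, the vertex $c_i$ lies in a part of maximum size of the clique partition $\mathcal{Y}-\{c_1,\dots,c_{i-1}\}$.
   Context: A clique partition of $G$ is a partition of $V(G)$ into cliques of $G$; $E(\mathcal{Y})$ denotes the set of edges of $G$ with both ends in a common part of $\mathcal{Y}$ (so $|E(\mathcal{Y})|=\sum_{Y\in\mathcal{Y}}\binom{|Y|}{2}$). For $C\subseteq V(G)$, $\mathcal{Y}-C$ denotes the collection of nonempty sets of the form $Y\setminus C$ with $Y\in\mathcal{Y}$; it is a clique partition of $G-C$. A "maximum clique of $\mathcal{Y}-S$" means a part of $\mathcal{Y}-S$ of largest size. -}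

module Defs where

open import Data.Bool using (Bool; true; false; _∧_; not)
open import Data.Nat using (ℕ; _<ᵇ_; _≤_)
open import Data.Nat.Combinatorics using (_C_)
open import Data.Fin using (Fin; toℕ; _≟_)
open import Data.Fin.Subset using (Subset; ∣_∣)
open import Data.Vec using (tabulate; lookup)
open import Data.List using (allFin; map)
open import Data.Nat.ListAction using (sum)
open import Data.Bool.ListAction using (any)
open import Relation.Nullary.Decidable using (⌊_⌋)
open import Relation.Binary.PropositionalEquality using (_≡_; _≢_)
open import Relation.Nullary using (¬_)
open import Data.Empty using (⊥)

record Graph (n : ℕ) : Set₁ where
  field
    Adj     : Fin n → Fin n → Set
    symm    : ∀ {u v} → Adj u v → Adj v u
    irrefl  : ∀ {v} → ¬ Adj v v
open Graph public

-- A clique partition of G, encoded by a labelling f : Fin n → Fin m: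
-- the parts are the nonempty fibres {v | f v ≡ j}.  Each part must be a clique.
IsCliquePartition : ∀ {n m} → Graph n → (Fin n → Fin m) → Set
IsCliquePartition G f = ∀ u v → u ≢ v → f u ≡ f v → Adj G u v

partSize : ∀ {n m} → (Fin n → Fin m) → Subset n → Fin m → ℕ
partSize f X j = ∣ tabulate (λ v → ⌊ f v ≟ j ⌋ ∧ not (lookup X v)) ∣

-- |E(Y − X)| = Σ_parts C(|part|, 2)
edgesLeft : ∀ {n m} → (Fin n → Fin m) → Subset n → ℕ
edgesLeft {m = m} f X = sum (map (λ j → partSize f X j C 2) (allFin m))

prefixSet : ∀ {n k} → (Fin k → Fin n) → ℕ → Subset n
prefixSet {k = k} σ i =
  tabulate (λ v → any (λ j → (toℕ j <ᵇ i) ∧ ⌊ σ j ≟ v ⌋) (allFin k))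

-- Order C greedily: repeatedly remove a not yet removed vertex c of C whose part in Y − P
-- (P = the vertices removed so far) is largest among such vertices.  Let Q be any part of
-- Y − P.  If Q meets C − P, the greedy choice bounds it.  Otherwise Q is also a part of
-- Y − C, and if it is nonempty it has a vertex v outside C.  Passing from C to the set
-- D = C − c + v of the same size changes |E(Y − ·)| by
-- |part of c in Y − C| − |part of v in Y − D|, which is ≥ 0 by minimality of C.  So
-- |Q| ≤ |part of v in Y − D| + 1 ≤ |part of c in Y − C| + 1 ≤ |part of c in Y − P|.
module Submission where

open import Defs
open import Data.Nat using (ℕ; _≤_)
open import Data.Fin using (Fin; toℕ)
open import Data.Fin.Subset using (Subset; ∣_∣; _∈_)
open import Data.Product using (Σ; _×_; ∃-syntax)
open import Function.Definitions using (Injective)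
open import Relation.Binary.PropositionalEquality using (_≡_)

open import Data.Bool using (Bool; true; false; T; _∧_; not)
open import Data.Bool.Properties using (T-≡; T-∧)
open import Data.Empty using (⊥-elim)
open import Data.Fin using (zero; suc; fromℕ<; _≟_)
open import Data.Fin.Properties using (any?; toℕ<n; toℕ-fromℕ<; <-cmp; suc-injective)
open import Data.Fin.Subset using (_∉_; _⊆_; ⊥; inside; outside)
open import Data.Fin.Subset.Properties
  using (_∈?_; ∉⊥; ∣⊥∣≡0; ⊆-antisym; p⊆q⇒∣p∣≤∣q∣; p⊂q⇒∣p∣<∣q∣)
open import Data.List using (allFin; filter)
import Data.List as List
open import Data.List.Extrema.Nat using (argmax; argmax-all; f[xs]≤f[argmax])
open import Data.List.Membership.Propositional using (lose)
open import Data.List.Membership.Propositional.Properties using (∈-allFin; ∈-filter⁺)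
import Data.List.Properties as Listₚ
import Data.List.Relation.Unary.All as All
open import Data.List.Relation.Unary.All.Properties using (all-filter)
open import Data.List.Relation.Unary.Any using (satisfied)
open import Data.List.Relation.Unary.Any.Properties using (any⁺; any⁻)
open import Data.Nat using (zero; suc; _+_; _<_; z≤n; s≤s; _<?_; _<ᵇ_)
open import Data.Nat.Combinatorics using (nC1≡n; nCk+nC[k+1]≡[n+1]C[k+1]) renaming (_C_ to _choose_)
open import Data.Nat.ListAction using (sum)
open import Data.Nat.Properties
  using (≤-refl; ≤-trans; ≤-reflexive; ≤-antisym; ≮⇒≥; <⇒≤; <⇒≱; <-irrefl; <-irrelevant;
         m≤n⇒m≤1+n; m<n⇒m<1+n; m<1+n⇒m<n∨m≡n; +-assoc; +-monoʳ-≤; +-cancelʳ-≤;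
         <⇒<ᵇ; <ᵇ⇒<; +-commutativeSemigroup; module ≤-Reasoning)
open import Data.Product using (_,_; proj₁; proj₂; ∃)
open import Algebra.Properties.CommutativeSemigroup +-commutativeSemigroup using (x∙yz≈y∙xz)
open import Data.Sum using (_⊎_; inj₁; inj₂; [_,_])
open import Data.Vec using (tabulate; lookup; _[_]≔_)
open import Data.Vec.Properties
  using ([]=⇒lookup; lookup⇒[]=; lookup∘tabulate; tabulate∘lookup; tabulate-cong;
         lookup∘update; lookup∘update′; []≔-updates)
open import Function using (_∘_; id)
open import Function.Bundles using (Equivalence)
open import Relation.Binary.Definitions using (tri<; tri≈; tri>)
open import Relation.Binary.PropositionalEquality
  using (_≢_; refl; sym; trans; cong; cong₂; subst; module ≡-Reasoning)
open import Relation.Nullary using (¬_; yes; no; contradiction)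
open import Relation.Nullary.Decidable
  using (⌊_⌋; toWitness; fromWitness; _×-dec_; ¬?; decidable-stable)
open import Relation.Unary using (Pred; Decidable)

open Equivalence using (to; from)

count : ∀ {n} → (Fin n → Bool) → ℕ
count p = ∣ tabulate p ∣

count-cong : ∀ {n} {p q : Fin n → Bool} → (∀ x → p x ≡ q x) → count p ≡ count q
count-cong = cong ∣_∣ ∘ tabulate-cong

count-mono : ∀ {n} {p q : Fin n → Bool} → (∀ x → T (p x) → T (q x)) → count p ≤ count q
count-mono {zero} _ = z≤n
count-mono {suc n} {p} {q} p⇒q with p zero | q zero | p⇒q zero
... | false | false | _ = count-mono (λ x → p⇒q (suc x))
... | false | true  | _ = m≤n⇒m≤1+n (count-mono (λ x → p⇒q (suc x)))
... | true  | true  | _ = s≤s (count-mono (λ x → p⇒q (suc x)))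
... | true  | false | q₀ = ⊥-elim (q₀ _)

count-point : ∀ {n} {p q : Fin n → Bool} (y : Fin n) → (∀ x → x ≢ y → p x ≡ q x) →
  ¬ T (p y) → T (q y) → count q ≡ suc (count p)
count-point {suc n} {p} {q} zero agree ¬py qy with p zero | q zero
... | false | true  = cong suc (count-cong λ x → sym (agree (suc x) λ ()))
... | true  | _     = ⊥-elim (¬py _)
... | false | false = ⊥-elim qy
count-point {suc n} {p} {q} (suc y) agree ¬py qy
  with p zero | q zero | agree zero (λ ())
     | count-point y (λ x x≢y → agree (suc x) (x≢y ∘ suc-injective)) ¬py qy
... | false | false | _ | rest = rest
... | true  | true  | _ | rest = cong suc rest

count-witness : ∀ {n} (p : Fin n → Bool) → 0 < count p → ∃[ x ] T (p x)
count-witness {suc n} p pos with p zero in p₀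
... | true  = zero , from T-≡ p₀
... | false = let x , px = count-witness (p ∘ suc) pos in suc x , px

∈⇒T-lookup : ∀ {n} {p : Subset n} {x} → x ∈ p → T (lookup p x)
∈⇒T-lookup = from T-≡ ∘ []=⇒lookup

T-lookup⇒∈ : ∀ {n} {p : Subset n} {x} → T (lookup p x) → x ∈ p
T-lookup⇒∈ {p = p} {x} = lookup⇒[]= x p ∘ to T-≡

∉⇒T-not-lookup : ∀ {n} {p : Subset n} {x} → x ∉ p → T (not (lookup p x))
∉⇒T-not-lookup {p = p} {x} x∉p with lookup p x in px
... | false = _
... | true  = x∉p (T-lookup⇒∈ (from T-≡ px))

T-not-lookup⇒∉ : ∀ {n} {p : Subset n} {x} → T (not (lookup p x)) → x ∉ p
T-not-lookup⇒∉ t x∈p = subst (T ∘ not) ([]=⇒lookup x∈p) t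

T⇒∈-tabulate : ∀ {n} {g : Fin n → Bool} {x} → T (g x) → x ∈ tabulate g
T⇒∈-tabulate {g = g} {x} = T-lookup⇒∈ ∘ subst T (sym (lookup∘tabulate g x))

∈-tabulate⇒T : ∀ {n} {g : Fin n → Bool} {x} → x ∈ tabulate g → T (g x)
∈-tabulate⇒T {g = g} {x} = subst T (lookup∘tabulate g x) ∘ ∈⇒T-lookup

∣p∣<∣q∣⇒∃∈q∉p : ∀ {n} {p q : Subset n} → ∣ p ∣ < ∣ q ∣ → ∃[ x ] x ∈ q × x ∉ p
∣p∣<∣q∣⇒∃∈q∉p {p = p} {q} ∣p∣<∣q∣ with any? (λ x → x ∈? q ×-dec ¬? (x ∈? p))
... | yes found = found
... | no none = contradiction (p⊆q⇒∣p∣≤∣q∣ q⊆p) (<⇒≱ ∣p∣<∣q∣)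
  where
  q⊆p : q ⊆ p
  q⊆p {x} x∈q = decidable-stable (x ∈? p) (λ x∉p → none (x , x∈q , x∉p))

argmax-on : ∀ {n ℓ} {Q : Pred (Fin n) ℓ} → Decidable Q → (w : Fin n → ℕ) → ∃ Q →
  ∃[ c ] Q c × (∀ {y} → Q y → w y ≤ w c)
argmax-on {n} Q? w (c₀ , Qc₀) =
  argmax w c₀ candidates ,
  argmax-all w Qc₀ (all-filter Q? (allFin n)) ,
  λ Qy → All.lookup (f[xs]≤f[argmax] c₀ candidates) (∈-filter⁺ Q? (∈-allFin _) Qy)
  where candidates = filter Q? (allFin n)

record Adds {n} (Y : Subset n) (y : Fin n) (X : Subset n) : Set where
  field
    fresh     : y ∉ Y
    added     : y ∈ X
    elsewhere : ∀ {x} → x ≢ y → lookup X x ≡ lookup Y x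

  ∈-smaller : ∀ {x} → x ≢ y → x ∈ X → x ∈ Y
  ∈-smaller x≢y = T-lookup⇒∈ ∘ subst T (elsewhere x≢y) ∘ ∈⇒T-lookup

  smaller⊆larger : Y ⊆ X
  smaller⊆larger {x} x∈Y = T-lookup⇒∈ (subst T (sym (elsewhere x≢y)) (∈⇒T-lookup x∈Y))
    where
    x≢y : x ≢ y
    x≢y refl = fresh x∈Y

  ∈-larger⁻ : ∀ {x} → x ∈ X → x ≡ y ⊎ x ∈ Y
  ∈-larger⁻ {x} x∈X with x ≟ y
  ... | yes x≡y = inj₁ x≡y
  ... | no x≢y  = inj₂ (∈-smaller x≢y x∈X)

  cardinality : ∣ X ∣ ≡ suc ∣ Y ∣
  cardinality = begin
    ∣ X ∣                    ≡⟨ cong ∣_∣ (sym (tabulate∘lookup X)) ⟩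
    count (lookup X)         ≡⟨ count-point y (λ _ x≢y → sym (elsewhere x≢y))
                                  (fresh ∘ T-lookup⇒∈) (∈⇒T-lookup added) ⟩
    suc (count (lookup Y))   ≡⟨ cong (suc ∘ ∣_∣) (tabulate∘lookup Y) ⟩
    suc ∣ Y ∣                ∎
    where open ≡-Reasoning

insert-adds : ∀ {n} {Y : Subset n} {y} → y ∉ Y → Adds Y y (Y [ y ]≔ inside)
insert-adds {Y = Y} {y} y∉Y = record
  { fresh     = y∉Y
  ; added     = []≔-updates Y y
  ; elsewhere = λ x≢y → lookup∘update′ x≢y Y inside
  }

remove-adds : ∀ {n} {X : Subset n} {y} → y ∈ X → Adds (X [ y ]≔ outside) y X
remove-adds {X = X} {y} y∈X = record
  { fresh     = T-not-lookup⇒∉ (subst (T ∘ not) (sym (lookup∘update y X outside)) _)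
  ; added     = y∈X
  ; elsewhere = λ x≢y → sym (lookup∘update′ x≢y X outside)
  }

sum-tabulate-bump : ∀ {m d} {h h′ : Fin m → ℕ} (a : Fin m) →
  (∀ j → j ≢ a → h′ j ≡ h j) →
  h′ a ≡ d + h a → sum (List.tabulate h′) ≡ d + sum (List.tabulate h)
sum-tabulate-bump {suc m} {d} {h} {h′} zero off at = begin
  h′ zero + sum (List.tabulate (h′ ∘ suc))
    ≡⟨ cong₂ _+_ at (cong sum (Listₚ.tabulate-cong λ j → off (suc j) λ ())) ⟩
  d + h zero + sum (List.tabulate (h ∘ suc)) ≡⟨ +-assoc d _ _ ⟩
  d + sum (List.tabulate h)                  ∎
  where open ≡-Reasoning
sum-tabulate-bump {suc m} {d} {h} {h′} (suc a) off at = begin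
  h′ zero + sum (List.tabulate (h′ ∘ suc))      ≡⟨ cong₂ _+_ (off zero λ ()) rest ⟩
  h zero + (d + sum (List.tabulate (h ∘ suc))) ≡⟨ x∙yz≈y∙xz (h zero) d _ ⟩
  d + sum (List.tabulate h)                     ∎
  where
  open ≡-Reasoning
  rest : sum (List.tabulate (h′ ∘ suc)) ≡ d + sum (List.tabulate (h ∘ suc))
  rest = sum-tabulate-bump a (λ j j≢a → off (suc j) (j≢a ∘ suc-injective)) at

suc-choose-2 : ∀ t → suc t choose 2 ≡ t + t choose 2
suc-choose-2 t = trans (sym (nCk+nC[k+1]≡[n+1]C[k+1] t 1)) (cong (_+ t choose 2) (nC1≡n t))

module _ {n m} (f : Fin n → Fin m) where

  MinimisesEdgesLeft : Subset n → Set
  MinimisesEdgesLeft C = ∀ X → ∣ X ∣ ≡ ∣ C ∣ → edgesLeft f C ≤ edgesLeft f X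

  counted : Subset n → Fin m → Fin n → Bool
  counted X j v = ⌊ f v ≟ j ⌋ ∧ not (lookup X v)

  counted⁺ : ∀ {X : Subset n} {j v} → f v ≡ j → v ∉ X → T (counted X j v)
  counted⁺ fv≡j v∉X = from T-∧ (fromWitness fv≡j , ∉⇒T-not-lookup v∉X)

  counted⁻ : ∀ {X : Subset n} {j v} → T (counted X j v) → f v ≡ j × v ∉ X
  counted⁻ t = let fv≟j , v∉X = to T-∧ t in toWitness fv≟j , T-not-lookup⇒∉ v∉X

  partSize-mono : ∀ {X Y : Subset n} {j} → (∀ {v} → f v ≡ j → v ∉ X → v ∉ Y) →
    partSize f X j ≤ partSize f Y j
  partSize-mono {X} {Y} {j} X⇒Y = count-mono {p = counted X j} {counted Y j} λ _ t →
    let fv≡j , v∉X = counted⁻ {X} t in counted⁺ {Y} fv≡j (X⇒Y fv≡j v∉X)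

  partSize-antitone : ∀ {X Y : Subset n} {j} → X ⊆ Y → partSize f Y j ≤ partSize f X j
  partSize-antitone X⊆Y = partSize-mono λ _ v∉Y v∈X → v∉Y (X⊆Y v∈X)

  module _ {X Y : Subset n} {y} (Y+y≡X : Adds Y y X) where
    open Adds Y+y≡X

    partSize-adds : partSize f Y (f y) ≡ suc (partSize f X (f y))
    partSize-adds = count-point {p = counted X (f y)} {counted Y (f y)} y
      (λ x x≢y → cong (λ b → ⌊ f x ≟ f y ⌋ ∧ not b) (elsewhere x≢y))
      (λ t → proj₂ (counted⁻ t) added)
      (counted⁺ refl fresh)

    partSize-adds-≢ : ∀ {j} → j ≢ f y → partSize f Y j ≡ partSize f X j
    partSize-adds-≢ j≢fy = ≤-antisym
      (partSize-mono λ fv≡j v∉Y v∈X →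
        [ (λ v≡y → j≢fy (trans (sym fv≡j) (cong f v≡y))) , v∉Y ] (∈-larger⁻ v∈X))
      (partSize-antitone smaller⊆larger)

    edgesLeft-adds : edgesLeft f Y ≡ partSize f X (f y) + edgesLeft f X
    edgesLeft-adds = begin
      edgesLeft f Y
        ≡⟨ cong sum (Listₚ.map-tabulate id (binom Y)) ⟩
      sum (List.tabulate (binom Y))
        ≡⟨ sum-tabulate-bump (f y) (λ _ → cong (_choose 2) ∘ partSize-adds-≢) bump ⟩
      partSize f X (f y) + sum (List.tabulate (binom X))
        ≡⟨ cong (λ xs → partSize f X (f y) + sum xs) (Listₚ.map-tabulate id (binom X)) ⟨
      partSize f X (f y) + edgesLeft f X
        ∎
      where
      open ≡-Reasoning
      binom : Subset n → Fin m → ℕ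
      binom Z j = partSize f Z j choose 2
      bump : binom Y (f y) ≡ partSize f X (f y) + binom X (f y)
      bump = trans (cong (_choose 2) partSize-adds) (suc-choose-2 (partSize f X (f y)))

  module _ {C : Subset n} (C-minimal : MinimisesEdgesLeft C) where

    swap-bound : ∀ {c v} → c ∈ C → v ∉ C → partSize f C (f v) ≤ suc (partSize f C (f c))
    swap-bound {c} {v} c∈C v∉C = begin
      partSize f C (f v)       ≤⟨ partSize-antitone (Adds.smaller⊆larger E+c≡C) ⟩
      partSize f E (f v)       ≡⟨ partSize-adds E+v≡D ⟩
      suc (partSize f D (f v)) ≤⟨ s≤s D-part≤C-part ⟩
      suc (partSize f C (f c)) ∎
      where
      open ≤-Reasoning
      E D : Subset n
      E = C [ c ]≔ outside
      D = E [ v ]≔ inside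
      E+c≡C : Adds E c C
      E+c≡C = remove-adds c∈C
      E+v≡D : Adds E v D
      E+v≡D = insert-adds (v∉C ∘ Adds.smaller⊆larger E+c≡C)
      ∣D∣≡∣C∣ : ∣ D ∣ ≡ ∣ C ∣
      ∣D∣≡∣C∣ = trans (Adds.cardinality E+v≡D) (sym (Adds.cardinality E+c≡C))
      D-part≤C-part : partSize f D (f v) ≤ partSize f C (f c)
      D-part≤C-part = +-cancelʳ-≤ (edgesLeft f D) _ _ (begin
        partSize f D (f v) + edgesLeft f D ≡⟨ edgesLeft-adds E+v≡D ⟨
        edgesLeft f E                      ≡⟨ edgesLeft-adds E+c≡C ⟩
        partSize f C (f c) + edgesLeft f C ≤⟨ +-monoʳ-≤ _ (C-minimal D ∣D∣≡∣C∣) ⟩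
        partSize f C (f c) + edgesLeft f D ∎)

    partSize-≤-removable : ∀ {P c} → P ⊆ C → c ∈ C → c ∉ P →
      ∀ j → partSize f C j ≤ partSize f P (f c)
    partSize-≤-removable {P} {c} P⊆C c∈C c∉P j = begin
      partSize f C j           ≤⟨ C-part≤ ⟩
      suc (partSize f C (f c)) ≡⟨ partSize-adds E+c≡C ⟨
      partSize f E (f c)       ≤⟨ partSize-antitone P⊆E ⟩
      partSize f P (f c)       ∎
      where
      open ≤-Reasoning
      E : Subset n
      E = C [ c ]≔ outside
      E+c≡C : Adds E c C
      E+c≡C = remove-adds c∈C
      P⊆E : P ⊆ E
      P⊆E x∈P = Adds.∈-smaller E+c≡C (λ { refl → c∉P x∈P }) (P⊆C x∈P)
      C-part≤ : partSize f C j ≤ suc (partSize f C (f c))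
      C-part≤ with 0 <? partSize f C j
      ... | no ¬pos = ≤-trans (≮⇒≥ ¬pos) z≤n
      ... | yes pos with count-witness (counted C j) pos
      ...   | v , v-counted with counted⁻ {C} v-counted
      ...     | refl , v∉C = swap-bound c∈C v∉C

    greedy-step : ∀ {P} → P ⊆ C → ∣ P ∣ < ∣ C ∣ →
      ∃[ c ] c ∈ C × c ∉ P × (∀ j → partSize f P j ≤ partSize f P (f c))
    greedy-step {P} P⊆C ∣P∣<∣C∣
      with argmax-on candidate? (λ x → partSize f P (f x)) (∣p∣<∣q∣⇒∃∈q∉p ∣P∣<∣C∣)
      where
      candidate? : Decidable (λ x → x ∈ C × x ∉ P)
      candidate? x = x ∈? C ×-dec ¬? (x ∈? P)
    ... | c , (c∈C , c∉P) , c-maximal = c , c∈C , c∉P , largest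
      where
      largest : ∀ j → partSize f P j ≤ partSize f P (f c)
      largest j with any? (λ y → (y ∈? C ×-dec ¬? (y ∈? P)) ×-dec f y ≟ j)
      ... | yes (y , candidate , refl) = c-maximal candidate
      ... | no none = ≤-trans
        (partSize-mono λ {v} fv≡j v∉P v∈C → none (v , (v∈C , v∉P) , fv≡j))
        (partSize-≤-removable P⊆C c∈C c∉P j)

∈-prefixSet⁺ : ∀ {n k} (σ : Fin k → Fin n) {i j} → toℕ j < i → σ j ∈ prefixSet σ i
∈-prefixSet⁺ σ {i} {j} j<i =
  T⇒∈-tabulate (any⁺ earlier (lose (∈-allFin j) (from T-∧ (<⇒<ᵇ j<i , fromWitness refl))))
  where
  earlier : Fin _ → Bool
  earlier j′ = (toℕ j′ <ᵇ i) ∧ ⌊ σ j′ ≟ σ j ⌋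

∈-prefixSet⁻ : ∀ {n k} (σ : Fin k → Fin n) {i v} → v ∈ prefixSet σ i →
  ∃[ j ] toℕ j < i × σ j ≡ v
∈-prefixSet⁻ {k = k} σ v∈ with satisfied (any⁻ _ (allFin k) (∈-tabulate⇒T v∈))
... | j , t = let j<ᵇi , σj≟v = to T-∧ t in j , <ᵇ⇒< _ _ j<ᵇi , toWitness σj≟v

module GreedyOrdering {n} (C : Subset n) (R : Subset n → Fin n → Set)
  (step : ∀ P → P ⊆ C → ∣ P ∣ < ∣ C ∣ → ∃[ c ] c ∈ C × c ∉ P × R P c) where

  -- The first i chosen vertices; the bound on i is what makes step applicable.
  mutual
    removed : ∀ i → i ≤ ∣ C ∣ → Subset n
    removed zero    _   = ⊥
    removed (suc i) i<k = removed i (<⇒≤ i<k) [ next i i<k ]≔ inside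

    choice : ∀ i (i<k : i < ∣ C ∣) →
      ∃[ c ] c ∈ C × c ∉ removed i (<⇒≤ i<k) × R (removed i (<⇒≤ i<k)) c
    choice i i<k = step _ (removed-⊆ i _) (subst (_< ∣ C ∣) (sym (∣removed∣ i _)) i<k)

    next : ∀ i → i < ∣ C ∣ → Fin n
    next i i<k = proj₁ (choice i i<k)

    removed-adds : ∀ i (i<k : i < ∣ C ∣) →
      Adds (removed i (<⇒≤ i<k)) (next i i<k) (removed (suc i) i<k)
    removed-adds i i<k = insert-adds (proj₁ (proj₂ (proj₂ (choice i i<k))))

    removed-⊆ : ∀ i (i≤k : i ≤ ∣ C ∣) → removed i i≤k ⊆ C
    removed-⊆ zero    _   x∈⊥ = contradiction x∈⊥ ∉⊥
    removed-⊆ (suc i) i<k x∈  with Adds.∈-larger⁻ (removed-adds i i<k) x∈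
    ... | inj₁ refl = proj₁ (proj₂ (choice i i<k))
    ... | inj₂ x∈P  = removed-⊆ i _ x∈P

    ∣removed∣ : ∀ i (i≤k : i ≤ ∣ C ∣) → ∣ removed i i≤k ∣ ≡ i
    ∣removed∣ zero    _   = ∣⊥∣≡0 n
    ∣removed∣ (suc i) i<k =
      trans (Adds.cardinality (removed-adds i i<k)) (cong suc (∣removed∣ i _))

  next-irrelevant : ∀ {i j} (i<k : i < ∣ C ∣) (j<k : j < ∣ C ∣) → i ≡ j →
    next i i<k ≡ next j j<k
  next-irrelevant i<k j<k refl = cong (next _) (<-irrelevant i<k j<k)

  σ : Fin ∣ C ∣ → Fin n
  σ j = next (toℕ j) (toℕ<n j)

  ∈-removed⁺ : ∀ {i} (i≤k : i ≤ ∣ C ∣) {j} → toℕ j < i → σ j ∈ removed i i≤k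
  ∈-removed⁺ {suc i} i<k {j} j<1+i with m<1+n⇒m<n∨m≡n j<1+i
  ... | inj₁ j<i = Adds.smaller⊆larger (removed-adds i i<k) (∈-removed⁺ _ j<i)
  ... | inj₂ j≡i = subst (_∈ removed (suc i) i<k) (next-irrelevant i<k _ (sym j≡i))
                     (Adds.added (removed-adds i i<k))

  ∈-removed⁻ : ∀ {i} (i≤k : i ≤ ∣ C ∣) {v} → v ∈ removed i i≤k →
    ∃[ j ] toℕ j < i × σ j ≡ v
  ∈-removed⁻ {zero}  _   v∈⊥ = contradiction v∈⊥ ∉⊥
  ∈-removed⁻ {suc i} i<k v∈  with Adds.∈-larger⁻ (removed-adds i i<k) v∈
  ... | inj₁ refl =
    fromℕ< i<k , s≤s (≤-reflexive (toℕ-fromℕ< i<k)) , next-irrelevant _ i<k (toℕ-fromℕ< i<k)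
  ... | inj₂ v∈P  = let j , j<i , σj≡v = ∈-removed⁻ _ v∈P in j , m<n⇒m<1+n j<i , σj≡v

  removed≡prefixSet : ∀ {i} (i≤k : i ≤ ∣ C ∣) → removed i i≤k ≡ prefixSet σ i
  removed≡prefixSet i≤k = ⊆-antisym
    (λ v∈ → let j , j<i , σj≡v = ∈-removed⁻ i≤k v∈ in subst (_∈ _) σj≡v (∈-prefixSet⁺ σ j<i))
    (λ v∈ → let j , j<i , σj≡v = ∈-prefixSet⁻ σ v∈ in subst (_∈ _) σj≡v (∈-removed⁺ i≤k j<i))

  σ-step : ∀ i → σ i ∈ C × σ i ∉ prefixSet σ (toℕ i) × R (prefixSet σ (toℕ i)) (σ i)
  σ-step i = subst (λ P → σ i ∈ C × σ i ∉ P × R P (σ i))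
    (removed≡prefixSet (<⇒≤ (toℕ<n i))) (proj₂ (choice (toℕ i) (toℕ<n i)))

  σ-injective : Injective _≡_ _≡_ σ
  σ-injective {i} {j} σi≡σj with <-cmp i j
  ... | tri< i<j _ _ = contradiction
    (subst (_∈ prefixSet σ (toℕ j)) σi≡σj (∈-prefixSet⁺ σ i<j)) (proj₁ (proj₂ (σ-step j)))
  ... | tri≈ _ i≡j _ = i≡j
  ... | tri> _ _ j<i = contradiction
    (subst (_∈ prefixSet σ (toℕ i)) (sym σi≡σj) (∈-prefixSet⁺ σ j<i)) (proj₁ (proj₂ (σ-step i)))

  σ-surjective : ∀ v → v ∈ C → ∃[ i ] σ i ≡ v
  σ-surjective v v∈C with v ∈? removed ∣ C ∣ ≤-refl
  ... | yes v∈ = let i , _ , σi≡v = ∈-removed⁻ ≤-refl v∈ in i , σi≡v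
  ... | no v∉  = contradiction
    (p⊂q⇒∣p∣<∣q∣ (removed-⊆ _ ≤-refl , v , v∈C , v∉)) (<-irrefl (∣removed∣ _ ≤-refl))

greedyOrdering : ∀ {n} (C : Subset n) (R : Subset n → Fin n → Set) →
  (∀ P → P ⊆ C → ∣ P ∣ < ∣ C ∣ → ∃[ c ] c ∈ C × c ∉ P × R P c) →
  Σ (Fin ∣ C ∣ → Fin n) λ σ →
    Injective _≡_ _≡_ σ × (∀ i → σ i ∈ C) × (∀ v → v ∈ C → ∃[ i ] σ i ≡ v) ×
    (∀ i → R (prefixSet σ (toℕ i)) (σ i))
greedyOrdering C R step =
  σ , σ-injective , proj₁ ∘ σ-step , σ-surjective , proj₂ ∘ proj₂ ∘ σ-step
  where open GreedyOrdering C R step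

lemma10 : ∀ {n m} (G : Graph n) (f : Fin n → Fin m) → IsCliquePartition G f →
    (C : Subset n) →
    (∀ (X : Subset n) → ∣ X ∣ ≡ ∣ C ∣ → edgesLeft f C ≤ edgesLeft f X) →
    Σ (Fin ∣ C ∣ → Fin n) λ σ →
      Injective _≡_ _≡_ σ × (∀ i → σ i ∈ C) × (∀ v → v ∈ C → ∃[ i ] σ i ≡ v) ×
      (∀ (i : Fin ∣ C ∣) (j : Fin m) →
        partSize f (prefixSet σ (toℕ i)) j ≤ partSize f (prefixSet σ (toℕ i)) (f (σ i)))
lemma10 _ f _ C C-minimal =
  greedyOrdering C (λ P c → ∀ j → partSize f P j ≤ partSize f P (f c))
    (λ _ → greedy-step f C-minimal)
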